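{- If $n_1\ge n_2\ge n_3\ge 4$, then $\mu_{\rm t}(K_{n_1}\,\square\, K_{n_2}\,\square\, K_{n_3}) = n_1+n_2+n_3-6$.
   Context: For a connected graph $G$ and $X\subseteq V(G)$, two vertices $x,y$ are $X$-visible if there is a shortest $x,y$-path none of whose internal vertices lies in $X$. $X$ is a total mutual-visibility set if every two vertices of $V(G)$ are $X$-visible. $\mu_{\rm t}(G)$ is the maximum cardinality of a total mutual-visibility set of $G$. $\square$ denotes the Cartesian product of graphs and $K_n$ the complete graph on $n$ vertices. -}

module Defs where

open import Data.Nat using (ℕ; zero; suc; _≤_)
open import Data.Fin using (Fin)
open import Data.Product using (_×_; _,_; ∃-syntax)
open import Data.Sum using (_⊎_)
open import Data.Unit using (⊤)
open import Data.List using (List; length)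
open import Data.List.Membership.Propositional using (_∈_; _∉_)
open import Data.List.Relation.Unary.Unique.Propositional using (Unique)
open import Relation.Binary.PropositionalEquality using (_≡_; _≢_)

record Graph : Set₁ where
  field
    V   : Set
    Adj : V → V → Set
open Graph public

K : ℕ → Graph
K n = record { V = Fin n ; Adj = λ i j → i ≢ j }

_□_ : Graph → Graph → Graph
G □ H = record
  { V   = V G × V H
  ; Adj = λ { (g , h) (g' , h') → (Adj G g g' × h ≡ h') ⊎ (g ≡ g' × Adj H h h') } }
infixr 6 _□_

data Walk (G : Graph) : V G → V G → Set where
  []  : ∀ {x} → Walk G x x
  _∷_ : ∀ {x y z} → Adj G x y → Walk G y z → Walk G x z

len : ∀ {G x y} → Walk G x y → ℕ
len []      = zero
len (_ ∷ w) = suc (len w)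

IsShortest : ∀ {G x y} → Walk G x y → Set
IsShortest {G} {x} {y} w = ∀ (w' : Walk G x y) → len w ≤ len w'

InternalAvoid : ∀ {G x y} → List (V G) → Walk G x y → Set
InternalAvoid X []                 = ⊤
InternalAvoid X (_ ∷ [])           = ⊤
InternalAvoid X (_∷_ {y = v} _ (e ∷ w)) = (v ∉ X) × InternalAvoid X (e ∷ w)

Visible : (G : Graph) → List (V G) → V G → V G → Set
Visible G X x y = ∃[ w ] (IsShortest {G} {x} {y} w × InternalAvoid X w)

IsTMV : (G : Graph) → List (V G) → Set
IsTMV G X = Unique X × (∀ x y → Visible G X x y)

MuT≡ : Graph → ℕ → Set
MuT≡ G k = (∃[ X ] (IsTMV G X × length X ≡ k))
         × (∀ X → IsTMV G X → length X ≤ k)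

{-# OPTIONS --safe #-}
module Submission where

-- A set X is a total mutual-visibility set exactly when no two of its points are at distance
-- two. Such a pair u, v would be the only common neighbours of two other points at distance two,
-- which are then not X-visible. Conversely, if X has no such pair, any two points are joined by
-- a shortest walk changing the differing coordinates one at a time: of the two possible corners
-- at each stage, which are themselves at distance two, at most one lies in X.
--
-- For the upper bound, all X-neighbours of a point of X lie along one axis; classify the points
-- by that axis. Points of class k are determined by their k-th coordinate, and points of
-- different classes differ in every coordinate. So in coordinate k the points of class k and one
-- representative of every other nonempty class take distinct values, while an empty class k
-- leaves all n_k ≥ 4 values unused; altogether at least six coordinate values stay unused.

open import Defs
open import Data.Bool using (Bool; true; false; if_then_else_)
open import Data.Empty using (⊥; ⊥-elim)
open import Data.Fin using (Fin; zero; suc; _≟_)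
open import Data.Fin.Properties using (suc-injective)
open import Data.List using (List; []; _∷_; length; _++_; map; filter; allFin)
open import Data.List.Properties using (length-++; length-map; length-tabulate; length-removeAt′; filter-none)
open import Data.List.Membership.Propositional using (_∈_; _∉_; find; lose)
open import Data.List.Membership.Propositional.Properties
  using (∈-allFin; ∈-map⁻; ∈-++⁻; ∈-filter⁻; ∈-AllPairs₂)
import Data.List.Membership.DecPropositional as DecMembership
open import Data.List.Relation.Binary.Disjoint.Propositional using (Disjoint)
open import Data.List.Relation.Unary.All as All using (All; []; _∷_)
open import Data.List.Relation.Unary.All.Properties using (¬Any⇒All¬)
import Data.List.Relation.Unary.All.Properties as All
open import Data.List.Relation.Unary.AllPairs as AllPairs using (AllPairs; []; _∷_)
open import Data.List.Relation.Unary.Any using (Any; here; there; any?; _─_; index)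
open import Data.List.Relation.Unary.Unique.Propositional using (Unique)
open import Data.List.Relation.Unary.Unique.Propositional.Properties
  using (++⁺; map⁺; allFin⁺; filter⁺)
open import Data.Nat using (ℕ; suc; _+_; _∸_; _≤_; _≥_; z≤n; s≤s)
open import Data.Nat.Properties
  using (≤-trans; ≤-reflexive; ≤-antisym; +-mono-≤; +-monoʳ-≤; +-suc; +-assoc;
         m+n≤o⇒m≤o∸n; m+n∸n≡m; ≤ᵇ⇒≤; module ≤-Reasoning)
open import Data.Nat.Tactic.RingSolver using (solve-∀)
open import Data.Product using (_×_; _,_; proj₁; proj₂; Σ-syntax; ∃-syntax)
open import Data.Product.Properties using (≡-dec)
open import Data.Sum using (_⊎_; inj₁; inj₂; [_,_])
import Data.Sum as Sum
open import Data.Unit using (tt)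
open import Function using (id; _∘_; _∘₂_)
open import Relation.Binary.PropositionalEquality
  using (_≡_; _≢_; refl; sym; trans; cong; cong₂; subst; module ≡-Reasoning)
open import Relation.Nullary using (¬_; Dec; yes; no; does)
open import Relation.Nullary.Decidable using (_×-dec_; ¬?; dec-true; dec-false)

module _ {A : Set} where

  ∈-─ : ∀ {x z : A} {xs} (x∈xs : x ∈ xs) → z ∈ xs → z ≢ x → z ∈ (xs ─ x∈xs)
  ∈-─ (here refl) (here refl) z≢x = ⊥-elim (z≢x refl)
  ∈-─ (here refl) (there z∈xs) _  = z∈xs
  ∈-─ (there _)   (here refl)  _  = here refl
  ∈-─ (there x∈xs) (there z∈xs) z≢x = there (∈-─ x∈xs z∈xs z≢x)

  ∈-either : ∀ {x y z : A} {xs} → x ∈ xs → y ∈ xs → z ≡ x ⊎ z ≡ y → z ∈ xs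
  ∈-either x∈xs _ (inj₁ refl) = x∈xs
  ∈-either _ y∈xs (inj₂ refl) = y∈xs

  Unique-⊆⇒length≤ : ∀ {xs ys : List A} → Unique xs → (∀ {z} → z ∈ xs → z ∈ ys) →
                     length xs ≤ length ys
  Unique-⊆⇒length≤ {[]}     _              _      = z≤n
  Unique-⊆⇒length≤ {x ∷ xs} {ys} (x∉xs ∷ u) xs⊆ys = begin
    suc (length xs)          ≤⟨ s≤s (Unique-⊆⇒length≤ u xs⊆ys─x) ⟩
    suc (length (ys ─ x∈ys)) ≡⟨ length-removeAt′ ys (index x∈ys) ⟨
    length ys                ∎
    where
    open ≤-Reasoning
    x∈ys : x ∈ ys
    x∈ys = xs⊆ys (here refl)
    xs⊆ys─x : ∀ {z} → z ∈ xs → z ∈ (ys ─ x∈ys)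
    xs⊆ys─x z∈xs = ∈-─ x∈ys (xs⊆ys (there z∈xs)) (All.lookup x∉xs z∈xs ∘ sym)

  Unique-map⁺ : ∀ {B : Set} {f : A → B} {xs} →
                (∀ {x y} → x ∈ xs → y ∈ xs → f x ≡ f y → x ≡ y) →
                Unique xs → Unique (map f xs)
  Unique-map⁺ f-inj [] = []
  Unique-map⁺ f-inj (x∉xs ∷ u) =
    All.map⁺ (All.tabulate λ y∈xs fx≡fy → All.lookup x∉xs y∈xs (f-inj (here refl) (there y∈xs) fx≡fy))
    ∷ Unique-map⁺ (λ x∈ y∈ → f-inj (there x∈) (there y∈)) u

Unique⇒length≤ : ∀ {n} {xs : List (Fin n)} → Unique xs → length xs ≤ n
Unique⇒length≤ {n} u =
  ≤-trans (Unique-⊆⇒length≤ u (λ {z} _ → ∈-allFin z)) (≤-reflexive (length-tabulate {n = n} id))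

-- Walks and visibility in arbitrary graphs

module _ {G H : Graph} where

  □-walk-split : ∀ {g g' h h'} (w : Walk (G □ H) (g , h) (g' , h')) →
                 Σ[ u ∈ Walk G g g' ] Σ[ v ∈ Walk H h h' ] len u + len v ≡ len w
  □-walk-split []                    = [] , [] , refl
  □-walk-split (inj₁ (e , refl) ∷ w) with u , v , eq ← □-walk-split w = e ∷ u , v , cong suc eq
  □-walk-split (inj₂ (refl , e) ∷ w) with u , v , eq ← □-walk-split w =
    u , e ∷ v , trans (+-suc (len u) (len v)) (cong suc eq)

  □-common-neighbours : ∀ {g g' h h' m} → g ≢ g' → h ≢ h' →
                        Adj (G □ H) (g , h) m → Adj (G □ H) m (g' , h') →
                        m ≡ (g' , h) ⊎ m ≡ (g , h')
  □-common-neighbours g≢g' h≢h' (inj₁ (_ , refl)) (inj₁ (_ , h≡h')) = ⊥-elim (h≢h' h≡h')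
  □-common-neighbours g≢g' h≢h' (inj₁ (_ , refl)) (inj₂ (refl , _)) = inj₁ refl
  □-common-neighbours g≢g' h≢h' (inj₂ (refl , _)) (inj₁ (_ , refl)) = inj₂ refl
  □-common-neighbours g≢g' h≢h' (inj₂ (refl , _)) (inj₂ (g≡g' , _)) = ⊥-elim (g≢g' g≡g')

  □-common-neighbours-fibre : ∀ {g h h' m} → (∀ {g} → ¬ Adj G g g) → h ≢ h' →
                              Adj (G □ H) (g , h) m → Adj (G □ H) m (g , h') →
                              Σ[ k ∈ V H ] m ≡ (g , k) × Adj H h k × Adj H k h'
  □-common-neighbours-fibre irr h≢h' (inj₁ (_ , refl)) (inj₁ (_ , h≡h')) = ⊥-elim (h≢h' h≡h')
  □-common-neighbours-fibre irr h≢h' (inj₁ (e , refl)) (inj₂ (refl , _)) = ⊥-elim (irr e)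
  □-common-neighbours-fibre irr h≢h' (inj₂ (refl , _)) (inj₁ (e , _))    = ⊥-elim (irr e)
  □-common-neighbours-fibre irr h≢h' (inj₂ (refl , e)) (inj₂ (refl , f)) = _ , refl , e , f

module _ {G : Graph} {X : List (V G)} where

  ¬visible-if-common-neighbours-in : ∀ {x y u} → Adj G x u → Adj G u y →
    (∀ (w : Walk G x y) → 2 ≤ len w) → (∀ {m} → Adj G x m → Adj G m y → m ∈ X) →
    ¬ Visible G X x y
  ¬visible-if-common-neighbours-in e f 2≤len commons∈X (w , shortest , avoids) =
    middle w (≤-antisym (shortest (e ∷ f ∷ [])) (2≤len w)) avoids
    where
    middle : ∀ (w : Walk G _ _) → len w ≡ 2 → InternalAvoid X w → ⊥
    middle (e' ∷ f' ∷ []) refl (m∉X , _) = m∉X (commons∈X e' f')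

module Avoidance (G : Graph) (X : List (V G)) where

  AvoidingWalk : V G → V G → ℕ → Set
  AvoidingWalk x y k = Σ[ w ∈ Walk G x y ] len w ≡ k × InternalAvoid X w

  edge-avoiding : ∀ {x y} → Adj G x y → AvoidingWalk x y 1
  edge-avoiding e = e ∷ [] , refl , tt

  extend-avoiding : ∀ {x m y k} → Adj G x m → m ∉ X → AvoidingWalk m y (suc k) →
                    AvoidingWalk x y (suc (suc k))
  extend-avoiding e m∉X (f ∷ w , refl , avoids) = e ∷ f ∷ w , refl , m∉X , avoids

  two-step-avoiding : ∀ {x y m₁ m₂} → Adj G x m₁ → Adj G m₁ y → Adj G x m₂ → Adj G m₂ y →
                      m₁ ∉ X ⊎ m₂ ∉ X → AvoidingWalk x y 2
  two-step-avoiding e₁ f₁ e₂ f₂ (inj₁ m₁∉X) = extend-avoiding e₁ m₁∉X (edge-avoiding f₁)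
  two-step-avoiding e₁ f₁ e₂ f₂ (inj₂ m₂∉X) = extend-avoiding e₂ m₂∉X (edge-avoiding f₂)

data Axis : Set where
  ax₁ ax₂ ax₃ : Axis

_≟ₐ_ : (i j : Axis) → Dec (i ≡ j)
ax₁ ≟ₐ ax₁ = yes refl
ax₁ ≟ₐ ax₂ = no λ ()
ax₁ ≟ₐ ax₃ = no λ ()
ax₂ ≟ₐ ax₁ = no λ ()
ax₂ ≟ₐ ax₂ = yes refl
ax₂ ≟ₐ ax₃ = no λ ()
ax₃ ≟ₐ ax₁ = no λ ()
ax₃ ≟ₐ ax₂ = no λ ()
ax₃ ≟ₐ ax₃ = yes refl

on-axis : ∀ {A : Set} → (A → Axis) → Axis → List A → List A
on-axis f k = filter (λ x → f x ≟ₐ k)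

length-by-axis : ∀ {A : Set} (f : A → Axis) xs →
  length xs ≡ length (on-axis f ax₁ xs) + length (on-axis f ax₂ xs) + length (on-axis f ax₃ xs)
length-by-axis f [] = refl
length-by-axis f (x ∷ xs) with f x | length-by-axis f xs
... | ax₁ | ih = cong suc ih
... | ax₂ | ih = trans (cong suc ih)
                   (cong (_+ length (on-axis f ax₃ xs)) (sym (+-suc (length (on-axis f ax₁ xs)) _)))
... | ax₃ | ih = trans (cong suc ih) (sym (+-suc (length (on-axis f ax₁ xs) + length (on-axis f ax₂ xs)) _))

sum-bounds : ∀ (a r n : Axis → ℕ) {s} → (∀ k → a k + r k ≤ n k) → s ≤ r ax₁ + r ax₂ + r ax₃ →
             a ax₁ + a ax₂ + a ax₃ ≤ n ax₁ + n ax₂ + n ax₃ ∸ s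
sum-bounds a r n {s} a+r≤n s≤r = m+n≤o⇒m≤o∸n Σa (begin
  Σa + s                                                  ≤⟨ +-monoʳ-≤ Σa s≤r ⟩
  Σa + (r ax₁ + r ax₂ + r ax₃)                            ≡⟨ interchange (a ax₁) (a ax₂) (a ax₃) (r ax₁) (r ax₂) (r ax₃) ⟩
  (a ax₁ + r ax₁) + (a ax₂ + r ax₂) + (a ax₃ + r ax₃)     ≤⟨ +-mono-≤ (+-mono-≤ (a+r≤n ax₁) (a+r≤n ax₂)) (a+r≤n ax₃) ⟩
  n ax₁ + n ax₂ + n ax₃                                   ∎)
  where
  open ≤-Reasoning
  Σa : ℕ
  Σa = a ax₁ + a ax₂ + a ax₃
  interchange : ∀ a₁ a₂ a₃ r₁ r₂ r₃ →
                a₁ + a₂ + a₃ + (r₁ + r₂ + r₃) ≡ (a₁ + r₁) + (a₂ + r₂) + (a₃ + r₃)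
  interchange = solve-∀

-- reserve occupied₁ occupied₂ occupied₃ counts values of its own coordinate that the first
-- class leaves unused: one per other nonempty class, or 4 (of at least 4) when it is empty.
reserve : Bool → Bool → Bool → ℕ
reserve false _     _     = 4
reserve true  false false = 0
reserve true  true  false = 1
reserve true  false true  = 1
reserve true  true  true  = 2

reserve-total : ∀ p₁ p₂ p₃ → 6 ≤ reserve p₁ p₂ p₃ + reserve p₂ p₁ p₃ + reserve p₃ p₁ p₂
reserve-total true  true  true  = ≤ᵇ⇒≤ 6 _ _
reserve-total true  true  false = ≤ᵇ⇒≤ 6 _ _
reserve-total true  false true  = ≤ᵇ⇒≤ 6 _ _
reserve-total true  false false = ≤ᵇ⇒≤ 6 _ _
reserve-total false true  true  = ≤ᵇ⇒≤ 6 _ _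
reserve-total false true  false = ≤ᵇ⇒≤ 6 _ _
reserve-total false false true  = ≤ᵇ⇒≤ 6 _ _
reserve-total false false false = ≤ᵇ⇒≤ 6 _ _

-- The Hamming graph K n₁ □ K n₂ □ K n₃

mismatch : ∀ {A : Set} → Dec A → ℕ
mismatch a? = if does a? then 0 else 1

δ : ∀ {n} → Fin n → Fin n → ℕ
δ a b = mismatch (a ≟ b)

δ-refl : ∀ {n} (a : Fin n) → δ a a ≡ 0
δ-refl a rewrite dec-true (a ≟ a) refl = refl

δ-≢ : ∀ {n} {a b : Fin n} → a ≢ b → δ a b ≡ 1
δ-≢ {a = a} {b} a≢b rewrite dec-false (a ≟ b) a≢b = refl

δ≤len : ∀ {n} {a b : Fin n} (w : Walk (K n) a b) → δ a b ≤ len w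
δ≤len {a = a} []      = ≤-reflexive (δ-refl a)
δ≤len {a = a} {b} (_ ∷ _) with does (a ≟ b)
... | true  = z≤n
... | false = s≤s z≤n

module HammingGraph (n₁ n₂ n₃ : ℕ) where

  G : Graph
  G = K n₁ □ K n₂ □ K n₃

  Point : Set
  Point = Fin n₁ × Fin n₂ × Fin n₃

  variable
    a a' : Fin n₁
    b b' : Fin n₂
    c c' : Fin n₃
    x y u v : Point

  edge₁ : a ≢ a' → Adj G (a , b , c) (a' , b , c)
  edge₁ a≢a' = inj₁ (a≢a' , refl)

  edge₂ : b ≢ b' → Adj G (a , b , c) (a , b' , c)
  edge₂ b≢b' = inj₂ (refl , inj₁ (b≢b' , refl))

  edge₃ : c ≢ c' → Adj G (a , b , c) (a , b , c')
  edge₃ c≢c' = inj₂ (refl , inj₂ (refl , c≢c'))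

  hamming : Point → Point → ℕ
  hamming (a , b , c) (a' , b' , c') = δ a a' + (δ b b' + δ c c')

  hamming≤len : (w : Walk G x y) → hamming x y ≤ len w
  hamming≤len {x} {y} w
    with w₁ , w₂₃ , eq₁ ← □-walk-split w
    with w₂ , w₃ , eq₂₃ ← □-walk-split w₂₃ = begin
    hamming x y                ≤⟨ +-mono-≤ (δ≤len w₁) (+-mono-≤ (δ≤len w₂) (δ≤len w₃)) ⟩
    len w₁ + (len w₂ + len w₃) ≡⟨ cong (len w₁ +_) eq₂₃ ⟩
    len w₁ + len w₂₃           ≡⟨ eq₁ ⟩
    len w                      ∎
    where open ≤-Reasoning

  TwoApart : Point → Point → Set
  TwoApart (a , b , c) (a' , b' , c') =
    (a ≢ a' × b ≢ b' × c ≡ c') ⊎ (a ≢ a' × b ≡ b' × c ≢ c') ⊎ (a ≡ a' × b ≢ b' × c ≢ c')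

  NoTwoApart : List Point → Set
  NoTwoApart X = ∀ {u v} → u ∈ X → v ∈ X → ¬ TwoApart u v

  twoApart⇒hamming≡2 : ∀ x y → TwoApart x y → hamming x y ≡ 2
  twoApart⇒hamming≡2 (_ , _ , c) _ (inj₁ (p , q , refl))        rewrite δ-≢ p | δ-≢ q | δ-refl c = refl
  twoApart⇒hamming≡2 (_ , b , _) _ (inj₂ (inj₁ (p , refl , r))) rewrite δ-≢ p | δ-refl b | δ-≢ r = refl
  twoApart⇒hamming≡2 (a , _ , _) _ (inj₂ (inj₂ (refl , q , r))) rewrite δ-refl a | δ-≢ q | δ-≢ r = refl

  twoApart⇒2≤len : TwoApart x y → (w : Walk G x y) → 2 ≤ len w
  twoApart⇒2≤len {x} {y} x-y w = ≤-trans (≤-reflexive (sym (twoApart⇒hamming≡2 x y x-y))) (hamming≤len w)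

  module _ {X : List Point} (noTwoApart : NoTwoApart X) where

    open Avoidance G X

    one-outside : TwoApart u v → u ∉ X ⊎ v ∉ X
    one-outside {u} u-v with DecMembership._∈?_ (≡-dec _≟_ (≡-dec _≟_ _≟_)) u X
    ... | no  u∉X = inj₁ u∉X
    ... | yes u∈X = inj₂ (λ v∈X → noTwoApart u∈X v∈X u-v)

    route₁₂ : a ≢ a' → b ≢ b' → AvoidingWalk (a , b , c) (a' , b' , c) 2
    route₁₂ p q = two-step-avoiding (edge₁ p) (edge₂ q) (edge₂ q) (edge₁ p)
                    (one-outside (inj₁ (p ∘ sym , q , refl)))

    route₁₃ : a ≢ a' → c ≢ c' → AvoidingWalk (a , b , c) (a' , b , c') 2
    route₁₃ p r = two-step-avoiding (edge₁ p) (edge₃ r) (edge₃ r) (edge₁ p)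
                    (one-outside (inj₂ (inj₁ (p ∘ sym , refl , r))))

    route₂₃ : b ≢ b' → c ≢ c' → AvoidingWalk (a , b , c) (a , b' , c') 2
    route₂₃ q r = two-step-avoiding (edge₂ q) (edge₃ r) (edge₃ r) (edge₂ q)
                    (one-outside (inj₂ (inj₂ (refl , q ∘ sym , r))))

    route₁₂₃ : a ≢ a' → b ≢ b' → c ≢ c' → AvoidingWalk (a , b , c) (a' , b' , c') 3
    route₁₂₃ p q r =
      [ (λ m₁∉X → extend-avoiding (edge₁ p) m₁∉X (route₂₃ q r))
      , (λ m₂∉X → extend-avoiding (edge₂ q) m₂∉X (route₁₃ p r))
      ] (one-outside (inj₁ (p ∘ sym , q , refl)))

    -- The decisions are arguments so that the length reduces to the definition of hamming.
    route : (a? : Dec (a ≡ a')) (b? : Dec (b ≡ b')) (c? : Dec (c ≡ c')) →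
                     AvoidingWalk (a , b , c) (a' , b' , c') (mismatch a? + (mismatch b? + mismatch c?))
    route (yes refl) (yes refl) (yes refl) = [] , refl , tt
    route (no p)     (yes refl) (yes refl) = edge-avoiding (edge₁ p)
    route (yes refl) (no q)     (yes refl) = edge-avoiding (edge₂ q)
    route (yes refl) (yes refl) (no r)     = edge-avoiding (edge₃ r)
    route (no p)     (no q)     (yes refl) = route₁₂ p q
    route (no p)     (yes refl) (no r)     = route₁₃ p r
    route (yes refl) (no q)     (no r)     = route₂₃ q r
    route (no p)     (no q)     (no r)     = route₁₂₃ p q r

    noTwoApart⇒visible : ∀ x y → Visible G X x y
    noTwoApart⇒visible (a , b , c) (a' , b' , c')
      with w , len≡ , avoids ← route (a ≟ a') (b ≟ b') (c ≟ c') =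
      w , (λ w' → ≤-trans (≤-reflexive len≡) (hamming≤len w')) , avoids

  visible⇒noTwoApart : ∀ {X} → (∀ x y → Visible G X x y) → NoTwoApart X
  visible⇒noTwoApart visible u∈X v∈X (inj₁ (p , q , refl)) =
    ¬visible-if-common-neighbours-in (edge₂ (q ∘ sym)) (edge₁ p)
      (twoApart⇒2≤len (inj₁ (p , q ∘ sym , refl)))
      (∈-either v∈X u∈X ∘₂ □-common-neighbours {K n₁} {K n₂ □ K n₃} p (q ∘ sym ∘ cong proj₁))
      (visible _ _)
  visible⇒noTwoApart visible u∈X v∈X (inj₂ (inj₁ (p , refl , r))) =
    ¬visible-if-common-neighbours-in (edge₃ (r ∘ sym)) (edge₁ p)
      (twoApart⇒2≤len (inj₂ (inj₁ (p , refl , r ∘ sym))))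
      (∈-either v∈X u∈X ∘₂ □-common-neighbours {K n₁} {K n₂ □ K n₃} p (r ∘ sym ∘ cong proj₂))
      (visible _ _)
  visible⇒noTwoApart {X} visible {a , b , c} {_ , b' , c'} u∈X v∈X (inj₂ (inj₂ (refl , q , r))) =
    ¬visible-if-common-neighbours-in (edge₃ (r ∘ sym)) (edge₂ q)
      (twoApart⇒2≤len (inj₂ (inj₂ (refl , q , r ∘ sym))))
      commons∈X
      (visible _ _)
    where
    commons∈X : ∀ {m} → Adj G (a , b , c') m → Adj G m (a , b' , c) → m ∈ X
    commons∈X e f
      with k , refl , e' , f' ← □-common-neighbours-fibre {K n₁} {K n₂ □ K n₃} (λ a≢a → a≢a refl) (r ∘ sym ∘ cong proj₂) e f =
      ∈-either v∈X u∈X (Sum.map (cong (a ,_)) (cong (a ,_)) (□-common-neighbours {K n₂} {K n₃} q (r ∘ sym) e' f'))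

  size : Axis → ℕ
  size ax₁ = n₁
  size ax₂ = n₂
  size ax₃ = n₃

  coord : (k : Axis) → Point → Fin (size k)
  coord ax₁ (a , _ , _) = a
  coord ax₂ (_ , b , _) = b
  coord ax₃ (_ , _ , c) = c

  Along : Axis → Point → Point → Set
  Along ax₁ (a , b , c) (a' , b' , c') = a ≢ a' × b ≡ b' × c ≡ c'
  Along ax₂ (a , b , c) (a' , b' , c') = a ≡ a' × b ≢ b' × c ≡ c'
  Along ax₃ (a , b , c) (a' , b' , c') = a ≡ a' × b ≡ b' × c ≢ c'

  along? : ∀ k x y → Dec (Along k x y)
  along? ax₁ (a , b , c) (a' , b' , c') = ¬? (a ≟ a') ×-dec (b ≟ b') ×-dec (c ≟ c')
  along? ax₂ (a , b , c) (a' , b' , c') = (a ≟ a') ×-dec ¬? (b ≟ b') ×-dec (c ≟ c')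
  along? ax₃ (a , b , c) (a' , b' , c') = (a ≟ a') ×-dec (b ≟ b') ×-dec ¬? (c ≟ c')

  along-sym : ∀ k → Along k x y → Along k y x
  along-sym ax₁ (p , q , r) = p ∘ sym , sym q , sym r
  along-sym ax₂ (p , q , r) = sym p , q ∘ sym , sym r
  along-sym ax₃ (p , q , r) = sym p , sym q , r ∘ sym

  neighbours⇒same-axis-or-twoApart : ∀ {i j w₁ w₂} → Along i x w₁ → Along j x w₂ → i ≡ j ⊎ TwoApart w₁ w₂
  neighbours⇒same-axis-or-twoApart {i = ax₁} {ax₁} _ _ = inj₁ refl
  neighbours⇒same-axis-or-twoApart {i = ax₂} {ax₂} _ _ = inj₁ refl
  neighbours⇒same-axis-or-twoApart {i = ax₃} {ax₃} _ _ = inj₁ refl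
  neighbours⇒same-axis-or-twoApart {i = ax₁} {ax₂} (p , refl , refl) (refl , q , refl) = inj₂ (inj₁ (p ∘ sym , q , refl))
  neighbours⇒same-axis-or-twoApart {i = ax₁} {ax₃} (p , refl , refl) (refl , refl , r) = inj₂ (inj₂ (inj₁ (p ∘ sym , refl , r)))
  neighbours⇒same-axis-or-twoApart {i = ax₂} {ax₁} (refl , q , refl) (p , refl , refl) = inj₂ (inj₁ (p , q ∘ sym , refl))
  neighbours⇒same-axis-or-twoApart {i = ax₂} {ax₃} (refl , q , refl) (refl , refl , r) = inj₂ (inj₂ (inj₂ (refl , q ∘ sym , r)))
  neighbours⇒same-axis-or-twoApart {i = ax₃} {ax₁} (refl , refl , r) (p , refl , refl) = inj₂ (inj₂ (inj₁ (p , refl , r ∘ sym)))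
  neighbours⇒same-axis-or-twoApart {i = ax₃} {ax₂} (refl , refl , r) (refl , q , refl) = inj₂ (inj₂ (inj₂ (refl , q , r ∘ sym)))

  coord≡-cases : ∀ k → coord k x ≡ coord k y →
                 x ≡ y ⊎ TwoApart x y ⊎ Σ[ j ∈ Axis ] j ≢ k × Along j x y
  coord≡-cases {a , b , c} {_ , b' , c'} ax₁ refl with b ≟ b' | c ≟ c'
  ... | yes refl | yes refl = inj₁ refl
  ... | no q     | yes refl = inj₂ (inj₂ (ax₂ , (λ ()) , refl , q , refl))
  ... | yes refl | no r     = inj₂ (inj₂ (ax₃ , (λ ()) , refl , refl , r))
  ... | no q     | no r     = inj₂ (inj₁ (inj₂ (inj₂ (refl , q , r))))
  coord≡-cases {a , b , c} {a' , _ , c'} ax₂ refl with a ≟ a' | c ≟ c'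
  ... | yes refl | yes refl = inj₁ refl
  ... | no p     | yes refl = inj₂ (inj₂ (ax₁ , (λ ()) , p , refl , refl))
  ... | yes refl | no r     = inj₂ (inj₂ (ax₃ , (λ ()) , refl , refl , r))
  ... | no p     | no r     = inj₂ (inj₁ (inj₂ (inj₁ (p , refl , r))))
  coord≡-cases {a , b , c} {a' , b' , _} ax₃ refl with a ≟ a' | b ≟ b'
  ... | yes refl | yes refl = inj₁ refl
  ... | no p     | yes refl = inj₂ (inj₂ (ax₁ , (λ ()) , p , refl , refl))
  ... | yes refl | no q     = inj₂ (inj₂ (ax₂ , (λ ()) , refl , q , refl))
  ... | no p     | no q     = inj₂ (inj₁ (inj₁ (p , q , refl)))

  module Counting {X : List Point} (uniqueX : Unique X) (noTwoApart : NoTwoApart X) where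

    -- The axis along which z has its neighbours in X: they cannot lie along two different axes,
    -- as they would be two apart. Points without neighbours in X get the junk value ax₁.
    axis : Point → Axis
    axis z with any? (along? ax₂ z) X | any? (along? ax₃ z) X
    ... | yes _ | _     = ax₂
    ... | no _  | yes _ = ax₃
    ... | no _  | no _  = ax₁

    neighbour-axis-unique : ∀ {j k z w} → Any (Along j z) X → w ∈ X → Along k z w → j ≡ k
    neighbour-axis-unique has w∈X z-w with w' , w'∈X , z-w' ← find has =
      [ id , ⊥-elim ∘ noTwoApart w'∈X w∈X ] (neighbours⇒same-axis-or-twoApart z-w' z-w)

    axis-along : ∀ {k z w} → w ∈ X → Along k z w → axis z ≡ k
    axis-along {k} {z} {w} w∈X z-w with any? (along? ax₂ z) X | any? (along? ax₃ z) X
    ... | yes has₂ | _        = neighbour-axis-unique has₂ w∈X z-w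
    ... | no _     | yes has₃ = neighbour-axis-unique has₃ w∈X z-w
    ... | no ¬has₂ | no ¬has₃ = no-other-axis k z-w
      where
      no-other-axis : ∀ k → Along k z w → ax₁ ≡ k
      no-other-axis ax₁ _   = refl
      no-other-axis ax₂ z-w = ⊥-elim (¬has₂ (lose w∈X z-w))
      no-other-axis ax₃ z-w = ⊥-elim (¬has₃ (lose w∈X z-w))

    coord≡⇒same-axis : ∀ {k z w} → z ∈ X → w ∈ X → coord k z ≡ coord k w →
                       z ≡ w ⊎ (axis z ≡ axis w × axis z ≢ k)
    coord≡⇒same-axis {k} {z} {w} z∈X w∈X eq with coord≡-cases k eq
    ... | inj₁ z≡w                  = inj₁ z≡w
    ... | inj₂ (inj₁ z-w)            = ⊥-elim (noTwoApart z∈X w∈X z-w)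
    ... | inj₂ (inj₂ (j , j≢k , z-w)) =
      inj₂ (trans z-axis (sym (axis-along z∈X (along-sym j z-w))) , j≢k ∘ trans (sym z-axis))
      where
      z-axis : axis z ≡ j
      z-axis = axis-along w∈X z-w

    class : Axis → List Point
    class k = on-axis axis k X

    ∈-class⁻ : ∀ k {z} → z ∈ class k → z ∈ X × axis z ≡ k
    ∈-class⁻ k = ∈-filter⁻ (λ z → axis z ≟ₐ k)

    class+others≤size : ∀ k (W : List Point) → All (_∈ X) W → All (λ w → axis w ≢ k) W →
                        AllPairs (λ w w' → axis w ≢ axis w') W → length (class k) + length W ≤ size k
    class+others≤size k W W⊆X W-off-k W-distinct = begin
      length (class k) + length W           ≡⟨ length-++ (class k) ⟨
      length (class k ++ W)                 ≡⟨ length-map (coord k) (class k ++ W) ⟨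
      length (map (coord k) (class k ++ W)) ≤⟨ Unique⇒length≤ (Unique-map⁺ coord-injective unique) ⟩
      size k                                ∎
      where
      open ≤-Reasoning
      unique : Unique (class k ++ W)
      unique = ++⁺ (filter⁺ (λ z → axis z ≟ₐ k) uniqueX) (AllPairs.map (_∘ cong axis) W-distinct)
                   (λ (z∈class , z∈W) → All.lookup W-off-k z∈W (proj₂ (∈-class⁻ k z∈class)))
      ⊆X : ∀ {z} → z ∈ class k ++ W → z ∈ X
      ⊆X z∈ = [ proj₁ ∘ ∈-class⁻ k , All.lookup W⊆X ] (∈-++⁻ (class k) z∈)
      off-axis⇒∈W : ∀ {z} → z ∈ class k ++ W → axis z ≢ k → z ∈ W
      off-axis⇒∈W z∈ z≢k = [ ⊥-elim ∘ z≢k ∘ proj₂ ∘ ∈-class⁻ k , id ] (∈-++⁻ (class k) z∈)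
      axis-injective-on-W : ∀ {z w} → z ∈ W → w ∈ W → axis z ≡ axis w → z ≡ w
      axis-injective-on-W z∈W w∈W same =
        [ id , [ (λ ≢ → ⊥-elim (≢ same)) , (λ ≢ → ⊥-elim (≢ (sym same))) ] ]
          (∈-AllPairs₂ W-distinct z∈W w∈W)
      coord-injective : ∀ {z w} → z ∈ class k ++ W → w ∈ class k ++ W → coord k z ≡ coord k w → z ≡ w
      coord-injective z∈ w∈ eq =
        [ id
        , (λ (same , z≢k) → axis-injective-on-W (off-axis⇒∈W z∈ z≢k) (off-axis⇒∈W w∈ (z≢k ∘ trans same)) same)
        ] (coord≡⇒same-axis (⊆X z∈) (⊆X w∈) eq)

    Occupied : Axis → Set
    Occupied k = Any (λ z → axis z ≡ k) X

    occupied? : ∀ k → Dec (Occupied k)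
    occupied? k = any? (λ z → axis z ≟ₐ k) X

    unoccupied⇒class≡[] : ∀ {k} → ¬ Occupied k → class k ≡ []
    unoccupied⇒class≡[] {k} ¬occupied = filter-none (λ z → axis z ≟ₐ k) (¬Any⇒All¬ X ¬occupied)

    occupied : Axis → Bool
    occupied k = does (occupied? k)

    class+reserve≤size : ∀ k j l → j ≢ k → l ≢ k → j ≢ l → 4 ≤ size k →
      length (class k) + reserve (occupied k) (occupied j) (occupied l) ≤ size k
    class+reserve≤size k j l j≢k l≢k j≢l 4≤size with occupied? k | occupied? j | occupied? l
    ... | no ¬occupied | _ | _ =
      subst (λ xs → length xs + 4 ≤ size k) (sym (unoccupied⇒class≡[] ¬occupied)) 4≤size
    ... | yes _ | no _ | no _ = class+others≤size k [] [] [] []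
    ... | yes _ | yes has-j | no _ with zj , zj∈X , zj-axis ← find has-j =
      class+others≤size k (zj ∷ []) (zj∈X ∷ []) ((j≢k ∘ trans (sym zj-axis)) ∷ []) ([] ∷ [])
    ... | yes _ | no _ | yes has-l with zl , zl∈X , zl-axis ← find has-l =
      class+others≤size k (zl ∷ []) (zl∈X ∷ []) ((l≢k ∘ trans (sym zl-axis)) ∷ []) ([] ∷ [])
    ... | yes _ | yes has-j | yes has-l
      with zj , zj∈X , zj-axis ← find has-j
      with zl , zl∈X , zl-axis ← find has-l =
      class+others≤size k (zj ∷ zl ∷ []) (zj∈X ∷ zl∈X ∷ [])
        ((j≢k ∘ trans (sym zj-axis)) ∷ (l≢k ∘ trans (sym zl-axis)) ∷ [])
        (((λ same → j≢l (trans (sym zj-axis) (trans same zl-axis))) ∷ []) ∷ [] ∷ [])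

    reserve-of : Axis → ℕ
    reserve-of ax₁ = reserve (occupied ax₁) (occupied ax₂) (occupied ax₃)
    reserve-of ax₂ = reserve (occupied ax₂) (occupied ax₁) (occupied ax₃)
    reserve-of ax₃ = reserve (occupied ax₃) (occupied ax₁) (occupied ax₂)

    class+reserve-of≤size : (∀ k → 4 ≤ size k) → ∀ k → length (class k) + reserve-of k ≤ size k
    class+reserve-of≤size 4≤size ax₁ = class+reserve≤size ax₁ ax₂ ax₃ (λ ()) (λ ()) (λ ()) (4≤size ax₁)
    class+reserve-of≤size 4≤size ax₂ = class+reserve≤size ax₂ ax₁ ax₃ (λ ()) (λ ()) (λ ()) (4≤size ax₂)
    class+reserve-of≤size 4≤size ax₃ = class+reserve≤size ax₃ ax₁ ax₂ (λ ()) (λ ()) (λ ()) (4≤size ax₃)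

  upper-bound : ∀ {X} → 4 ≤ n₁ → 4 ≤ n₂ → 4 ≤ n₃ → IsTMV G X → length X ≤ n₁ + n₂ + n₃ ∸ 6
  upper-bound {X} 4≤n₁ 4≤n₂ 4≤n₃ (uniqueX , visible) = begin
    length X                                                     ≡⟨ length-by-axis axis X ⟩
    length (class ax₁) + length (class ax₂) + length (class ax₃) ≤⟨ sum-bounds (length ∘ class) reserve-of size
      (class+reserve-of≤size 4≤size) (reserve-total (occupied ax₁) (occupied ax₂) (occupied ax₃)) ⟩
    n₁ + n₂ + n₃ ∸ 6                                             ∎
    where
    open Counting uniqueX (visible⇒noTwoApart visible)
    open ≤-Reasoning
    4≤size : ∀ k → 4 ≤ size k
    4≤size ax₁ = 4≤n₁
    4≤size ax₂ = 4≤n₂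
    4≤size ax₃ = 4≤n₃

  ¬twoApart-separated : a ≢ a' → b ≢ b' → c ≢ c' → ¬ TwoApart (a , b , c) (a' , b' , c')
  ¬twoApart-separated _ _ c≢c' (inj₁ (_ , _ , c≡c'))        = c≢c' c≡c'
  ¬twoApart-separated _ b≢b' _ (inj₂ (inj₁ (_ , b≡b' , _))) = b≢b' b≡b'
  ¬twoApart-separated a≢a' _ _ (inj₂ (inj₂ (a≡a' , _ , _))) = a≢a' a≡a'

  ¬twoApart-line₁ : ¬ TwoApart (a , b , c) (a' , b , c)
  ¬twoApart-line₁ (inj₁ (_ , b≢b , _))        = b≢b refl
  ¬twoApart-line₁ (inj₂ (inj₁ (_ , _ , c≢c))) = c≢c refl
  ¬twoApart-line₁ (inj₂ (inj₂ (_ , b≢b , _))) = b≢b refl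

  ¬twoApart-line₂ : ¬ TwoApart (a , b , c) (a , b' , c)
  ¬twoApart-line₂ (inj₁ (a≢a , _ , _))        = a≢a refl
  ¬twoApart-line₂ (inj₂ (inj₁ (a≢a , _ , _))) = a≢a refl
  ¬twoApart-line₂ (inj₂ (inj₂ (_ , _ , c≢c))) = c≢c refl

  ¬twoApart-line₃ : ¬ TwoApart (a , b , c) (a , b , c')
  ¬twoApart-line₃ (inj₁ (a≢a , _ , _))        = a≢a refl
  ¬twoApart-line₃ (inj₂ (inj₁ (a≢a , _ , _))) = a≢a refl
  ¬twoApart-line₃ (inj₂ (inj₂ (_ , b≢b , _))) = b≢b refl

-- A total mutual-visibility set of size n₁ + n₂ + n₃ - 6

module Construction (m₁ m₂ m₃ : ℕ) where
  open HammingGraph (2 + m₁) (2 + m₂) (2 + m₃)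

  -- One line along each axis; points on different lines differ in every coordinate.
  line₁ : Fin m₁ → Point
  line₁ i = suc (suc i) , zero , zero

  line₂ : Fin m₂ → Point
  line₂ j = zero , suc (suc j) , suc zero

  line₃ : Fin m₃ → Point
  line₃ l = suc zero , suc zero , suc (suc l)

  L₁ L₂ L₃ X : List Point
  L₁ = map line₁ (allFin m₁)
  L₂ = map line₂ (allFin m₂)
  L₃ = map line₃ (allFin m₃)
  X  = L₁ ++ L₂ ++ L₃

  OnLines : Point → Set
  OnLines v = (∃[ i ] v ≡ line₁ i) ⊎ (∃[ j ] v ≡ line₂ j) ⊎ (∃[ l ] v ≡ line₃ l)

  ∈-line⁻ : ∀ {m v} (line : Fin m → Point) → v ∈ map line (allFin m) → ∃[ i ] v ≡ line i
  ∈-line⁻ line v∈ with i , _ , v≡ ← ∈-map⁻ line v∈ = i , v≡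

  ∈X⇒onLines : ∀ {v} → v ∈ X → OnLines v
  ∈X⇒onLines v∈X =
    Sum.map (∈-line⁻ line₁) (Sum.map (∈-line⁻ line₂) (∈-line⁻ line₃) ∘ ∈-++⁻ L₂)
      (∈-++⁻ L₁ v∈X)

  noTwoApart : NoTwoApart X
  noTwoApart u∈X v∈X = not-twoApart (∈X⇒onLines u∈X) (∈X⇒onLines v∈X)
    where
    not-twoApart : ∀ {u v} → OnLines u → OnLines v → ¬ TwoApart u v
    not-twoApart (inj₁ (_ , refl))        (inj₁ (_ , refl))        = ¬twoApart-line₁
    not-twoApart (inj₂ (inj₁ (_ , refl))) (inj₂ (inj₁ (_ , refl))) = ¬twoApart-line₂
    not-twoApart (inj₂ (inj₂ (_ , refl))) (inj₂ (inj₂ (_ , refl))) = ¬twoApart-line₃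
    not-twoApart (inj₁ (_ , refl))        (inj₂ (inj₁ (_ , refl))) = ¬twoApart-separated (λ ()) (λ ()) (λ ())
    not-twoApart (inj₁ (_ , refl))        (inj₂ (inj₂ (_ , refl))) = ¬twoApart-separated (λ ()) (λ ()) (λ ())
    not-twoApart (inj₂ (inj₁ (_ , refl))) (inj₁ (_ , refl))        = ¬twoApart-separated (λ ()) (λ ()) (λ ())
    not-twoApart (inj₂ (inj₁ (_ , refl))) (inj₂ (inj₂ (_ , refl))) = ¬twoApart-separated (λ ()) (λ ()) (λ ())
    not-twoApart (inj₂ (inj₂ (_ , refl))) (inj₁ (_ , refl))        = ¬twoApart-separated (λ ()) (λ ()) (λ ())
    not-twoApart (inj₂ (inj₂ (_ , refl))) (inj₂ (inj₁ (_ , refl))) = ¬twoApart-separated (λ ()) (λ ()) (λ ())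

  uniqueX : Unique X
  uniqueX = ++⁺ (map⁺ (suc-injective ∘ suc-injective ∘ cong proj₁) (allFin⁺ m₁))
                (++⁺ (map⁺ (suc-injective ∘ suc-injective ∘ cong (proj₁ ∘ proj₂)) (allFin⁺ m₂))
                     (map⁺ (suc-injective ∘ suc-injective ∘ cong (proj₂ ∘ proj₂)) (allFin⁺ m₃))
                     disjoint₂₃)
                disjoint₁
    where
    disjoint₂₃ : Disjoint L₂ L₃
    disjoint₂₃ (v∈₂ , v∈₃) with ∈-line⁻ line₂ v∈₂ | ∈-line⁻ line₃ v∈₃
    ... | _ , refl | _ , ()
    disjoint₁ : Disjoint L₁ (L₂ ++ L₃)
    disjoint₁ (v∈₁ , v∈₂₃) with ∈-line⁻ line₁ v∈₁ | ∈-++⁻ L₂ v∈₂₃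
    ... | _ , refl | inj₁ v∈₂ with ∈-line⁻ line₂ v∈₂
    ...   | _ , ()
    disjoint₁ (v∈₁ , v∈₂₃) | _ , refl | inj₂ v∈₃ with ∈-line⁻ line₃ v∈₃
    ...   | _ , ()

  length-X : length X ≡ m₁ + m₂ + m₃
  length-X = begin
    length (L₁ ++ L₂ ++ L₃)             ≡⟨ length-++ L₁ ⟩
    length L₁ + length (L₂ ++ L₃)       ≡⟨ cong (length L₁ +_) (length-++ L₂) ⟩
    length L₁ + (length L₂ + length L₃) ≡⟨ cong₂ _+_ (length-line line₁) (cong₂ _+_ (length-line line₂) (length-line line₃)) ⟩
    m₁ + (m₂ + m₃)                      ≡⟨ +-assoc m₁ m₂ m₃ ⟨
    m₁ + m₂ + m₃                        ∎
    where
    open ≡-Reasoning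
    length-line : ∀ {m} (line : Fin m → Point) → length (map line (allFin m)) ≡ m
    length-line {m} line = trans (length-map line (allFin m)) (length-tabulate {n = m} id)

lower-bound : ∀ {n₁ n₂ n₃} → 2 ≤ n₁ → 2 ≤ n₂ → 2 ≤ n₃ →
              ∃[ X ] IsTMV (K n₁ □ K n₂ □ K n₃) X × length X ≡ n₁ + n₂ + n₃ ∸ 6
lower-bound {suc (suc m₁)} {suc (suc m₂)} {suc (suc m₃)} (s≤s (s≤s _)) (s≤s (s≤s _)) (s≤s (s≤s _)) =
  X , (uniqueX , noTwoApart⇒visible noTwoApart) , (begin
    length X                                    ≡⟨ length-X ⟩
    m₁ + m₂ + m₃                                ≡⟨ m+n∸n≡m (m₁ + m₂ + m₃) 6 ⟨
    m₁ + m₂ + m₃ + 6 ∸ 6                        ≡⟨ cong (_∸ 6) (regroup m₁ m₂ m₃) ⟩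
    2 + m₁ + (2 + m₂) + (2 + m₃) ∸ 6           ∎)
  where
  open Construction m₁ m₂ m₃
  open HammingGraph (2 + m₁) (2 + m₂) (2 + m₃) using (noTwoApart⇒visible)
  open ≡-Reasoning
  regroup : ∀ a b c → a + b + c + 6 ≡ 2 + a + (2 + b) + (2 + c)
  regroup = solve-∀

theorem3p3 : (n₁ n₂ n₃ : ℕ) → n₁ ≥ n₂ → n₂ ≥ n₃ → n₃ ≥ 4 →
    MuT≡ (K n₁ □ K n₂ □ K n₃) (n₁ + n₂ + n₃ ∸ 6)
theorem3p3 n₁ n₂ n₃ n₁≥n₂ n₂≥n₃ n₃≥4 =
  lower-bound (4≤⇒2≤ 4≤n₁) (4≤⇒2≤ 4≤n₂) (4≤⇒2≤ n₃≥4) , λ X → upper-bound {X} 4≤n₁ 4≤n₂ n₃≥4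
  where
  open HammingGraph n₁ n₂ n₃ using (upper-bound)
  4≤n₂ : 4 ≤ n₂
  4≤n₂ = ≤-trans n₃≥4 n₂≥n₃
  4≤n₁ : 4 ≤ n₁
  4≤n₁ = ≤-trans 4≤n₂ n₁≥n₂
  4≤⇒2≤ : ∀ {n} → 4 ≤ n → 2 ≤ n
  4≤⇒2≤ = ≤-trans (s≤s (s≤s z≤n))
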